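{- Let $H$ be a hole in an oriented graph $G$ derived from a Burling tree $T$. Let $p$ be the pivot of $H$ and let $C$ be the connected component of $G\setminus N^-[p]$ that contains $H\setminus N^-[p]$. Then every vertex of $C$ is a descendant of $p$ in $T$.
   Context: Rooted trees: for a rooted tree $(T,r)$ and $v\neq r$, $p(v)$ is the parent of $v$. A branch is a path $v_1v_2\dots v_k$ of $T$ with $v_i$ the parent of $v_{i+1}$ for all $i$ (it starts at $v_1$); a branch may be empty. Descendants of $v$ are vertices on branches starting at $v$ (including $v$); ancestors of $v$ are vertices on the path from $v$ to the root (including $v$); strict = other than $v$. A Burling tree is a 4-tuple $(T,r,\ell,c)$ where $T$ is a rooted tree with root $r$; $\ell$ assigns to every non-leaf vertex $v$ one of its children $\ell(v)$, the last-born of $v$; and $c$ is a function on $V(T)$ such that if $v\neq r$ is not a last-born then $c(v)$ is the vertex set of a (possibly empty) branch of $T$ starting at $\ell(p(v))$, while $c(v)=\varnothing$ if $v$ is the root or a last-born. The oriented graph fully derived from the Burling tree has vertex set $V(T)$ and an arc $uv$ iff $v\in c(u)$. An oriented graph is derived from the Burling tree if it is an induced subgraph of the fully derived oriented graph. $N^-[p]$ is $p$ together with its in-neighbours in $G$. A hole of $G$ is an induced subgraph whose underlying graph is a cycle of length at least $4$. For a hole $H$ of $G$, let $S_H$ be the set of vertices $x$ of $H$ such that no strict ancestor of $x$ in $T$ lies in $H$. It is a fact that $H[S_H]$ consists of a vertex $p$ and two vertices $a,a'$ with arcs $ap,a'p$; $p$ is the pivot of $H$ and $a,a'$ are its antennas.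 The antennas are sources of $H$, the pivot is a sink of $H$ and an ancestor in $T$ of all vertices of $H$ other than the antennas, and $H$ has exactly one further sink, its bottom. -}

module Defs where

open import Data.Nat using (ℕ; zero; suc; _≤_)
open import Data.Fin using (Fin; toℕ)
open import Data.List using (List; []; _∷_)
open import Data.List.Membership.Propositional using (_∈_)
open import Data.Maybe using (Maybe; just; nothing)
open import Data.Product using (Σ; ∃; _×_; _,_)
open import Data.Sum using (_⊎_)
open import Relation.Nullary using (¬_)
open import Relation.Binary.PropositionalEquality using (_≡_; _≢_)

-- Rooted trees on the vertex set Fin n.
-- `par v ≡ just u` means u is the parent p(v) of v; the root has no parent.

data Anc {n : ℕ} (par : Fin n → Maybe (Fin n)) (u : Fin n) : Fin n → Set where
  anc-refl : Anc par u u
  anc-step : ∀ {v w} → par v ≡ just w → Anc par u w → Anc par u v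

record RootedTree (n : ℕ) : Set where
  field
    root      : Fin n
    par       : Fin n → Maybe (Fin n)
    par-root  : par root ≡ nothing
    par-only-root : ∀ v → par v ≡ nothing → v ≡ root
    reach-root : ∀ v → Anc par root v

data NonemptyBranch {n : ℕ} (par : Fin n → Maybe (Fin n)) (s : Fin n)
       : List (Fin n) → Set where
  nb-one  : NonemptyBranch par s (s ∷ [])
  nb-more : ∀ {y ys} → par y ≡ just s → NonemptyBranch par y (y ∷ ys)
          → NonemptyBranch par s (s ∷ y ∷ ys)

BranchFrom : {n : ℕ} → (Fin n → Maybe (Fin n)) → Fin n → List (Fin n) → Set
BranchFrom par s xs = xs ≡ [] ⊎ NonemptyBranch par s xs

-- Burling trees (T, r, ℓ, c).  ℓ is a total function whose value matters
-- only on non-leaves, where it must be a child.  c v is given as the list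
-- of vertices of a branch (its vertex set is list membership).

record BurlingTree (n : ℕ) : Set where
  field
    tree : RootedTree n
  open RootedTree tree public
  field
    ℓ        : Fin n → Fin n
    ℓ-child  : ∀ v → (∃ λ u → par u ≡ just v) → par (ℓ v) ≡ just v
    c        : Fin n → List (Fin n)
    c-root   : c root ≡ []
    c-last   : ∀ v w → par v ≡ just w → ℓ w ≡ v → c v ≡ []
    c-branch : ∀ v w → par v ≡ just w → ℓ w ≢ v → BranchFrom par (ℓ w) (c v)

module _ {n : ℕ} (B : BurlingTree n) where
  open BurlingTree B

  Ancestor : Fin n → Fin n → Set
  Ancestor u v = Anc par u v

  Arc : Fin n → Fin n → Set
  Arc u v = v ∈ c u

  Adj : Fin n → Fin n → Set
  Adj u v = Arc u v ⊎ Arc v u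

-- G is the induced subgraph of the fully derived graph on the vertex
-- set S.

CycNext : (k : ℕ) → Fin k → Fin k → Set
CycNext k i j = toℕ j ≡ suc (toℕ i) ⊎ (suc (toℕ i) ≡ k × toℕ j ≡ 0)

record Hole {n : ℕ} (B : BurlingTree n) (S : Fin n → Set) : Set where
  field
    k       : ℕ
    k≥4     : 4 ≤ k
    h       : Fin k → Fin n
    h-inj   : ∀ i j → h i ≡ h j → i ≡ j
    h-in-G  : ∀ i → S (h i)
    adj→cyc : ∀ i j → Adj B (h i) (h j) → CycNext k i j ⊎ CycNext k j i
    cyc→adj : ∀ i j → CycNext k i j → Adj B (h i) (h j)

module _ {n : ℕ} {B : BurlingTree n} {S : Fin n → Set} (H : Hole B S) where
  open Hole H

  InH : Fin n → Set
  InH x = ∃ λ i → h i ≡ x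

  InSH : Fin n → Set
  InSH x = InH x × (∀ y → InH y → Ancestor B y x → y ≡ x)

  IsPivot : Fin n → Set
  IsPivot p = InSH p × (Σ (Fin n) λ a → Σ (Fin n) λ a' →
      InSH a × InSH a' × a ≢ a' × a ≢ p × a' ≢ p × Arc B a p × Arc B a' p)

InNminus : {n : ℕ} → BurlingTree n → (Fin n → Set) → Fin n → Fin n → Set
InNminus B S p v = v ≡ p ⊎ (S v × Arc B v p)

-- Reach P E x y : y is reachable from x by a path of E-edges all of whose
-- vertices satisfy P (i.e. same component of the subgraph induced on P).
data Reach {n : ℕ} (P : Fin n → Set) (E : Fin n → Fin n → Set) (x : Fin n)
       : Fin n → Set where
  here : P x → Reach P E x x
  step : ∀ {y z} → Reach P E x y → E y z → P z → Reach P E x z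

-- The out-neighbourhood of a vertex u of a Burling tree is a tree interval running down from
-- the last-born sibling of u.  Hence a neighbour of a descendant v of t is a descendant of t, an
-- in-neighbour of t, or v = t itself; so descendance of t propagates along any path avoiding
-- t and its in-neighbours, and in particular through the component C of G ∖ N⁻[p].
--
-- It remains to find one vertex of H ∖ N⁻[p] below p.  Enumerate the hole as p, w₁, …, wₘ.
-- The antennas are w₁ and wₘ, and w₂, …, wₘ₋₁ is a path outside N⁻[p].  No wⱼ is an ancestor
-- of a wₗ with |j − l| ≥ 2: descendance of wⱼ would propagate from wₗ round the hole to p,
-- whereas p has no strict ancestor in H.  Thus no inner vertex has arcs to both its hole
-- neighbours (their targets would be comparable), so if the edge w₁w₂ points back, all edges
-- wⱼwⱼ₊₁ do.  Either w₁ → w₂ or wₘ → wₘ₋₁, and then p and w₂ (resp. wₘ₋₁) lie on one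
-- branch, which forces p to be the ancestor.
module Submission where

open import Defs
open import Data.Nat using (ℕ)
open import Data.Fin using (Fin)
open import Data.Product using (_×_)
open import Relation.Nullary using (¬_)
open import Data.Nat
  using (zero; suc; pred; _+_; _∸_; _≤_; _<_; _≤′_; ≤′-reflexive; ≤′-step; z≤n; s≤s;
         NonZero; >-nonZero; >-nonZero⁻¹)
open import Data.Nat.Properties hiding (_≟_)
open import Data.Nat.DivMod using (_%_; _mod_; %-distribˡ-+; m%n%n≡m%n; m%n<n; n%n≡0;
                                   m<n⇒m%n≡m; [m+n]%n≡m%n)
open import Data.Fin using (toℕ; _≟_)
open import Data.Fin.Properties using (toℕ<n; toℕ-injective; toℕ-fromℕ<)
open import Data.List using ([]; _∷_)
open import Data.List.Membership.Propositional using (_∈_)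
open import Data.List.Membership.Propositional.Properties.Core using (∉[])
open import Data.List.Relation.Unary.Any using (here; there)
open import Data.Maybe using (just; nothing)
open import Data.Maybe.Properties using (just-injective)
open import Data.Product using (∃; _,_; proj₁; proj₂)
import Data.Product as Product
import Data.Sum as Sum
open import Data.Sum using (_⊎_; inj₁; inj₂; [_,_]′; swap; map₂)
open import Data.Empty using (⊥-elim)
open import Function using (_∘_; id; _⇔_; mk⇔; Equivalence)
open import Relation.Nullary using (yes; no)
open import Relation.Binary.PropositionalEquality hiding ([_])

module _ {n : ℕ} {P : Fin n → Set} {E : Fin n → Fin n → Set} where

  reach-end : ∀ {x y} → Reach P E x y → P y
  reach-end (here Px) = Px
  reach-end (step _ _ Pz) = Pz

  reach-trans : ∀ {x y z} → Reach P E x y → Reach P E y z → Reach P E x z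
  reach-trans x~y (here _) = x~y
  reach-trans x~y (step y~z e Pu) = step (reach-trans x~y y~z) e Pu

  reach-sym : (∀ {u v} → E u v → E v u) → ∀ {x y} → Reach P E x y → Reach P E y x
  reach-sym E-sym (here Px) = here Px
  reach-sym E-sym (step x~y e Pz) = reach-trans (step (here Pz) (E-sym e) (reach-end x~y)) (reach-sym E-sym x~y)

  walk-reach : (w : ℕ → Fin n) → (∀ i → E (w i) (w (suc i))) →
               ∀ {a b} → a ≤ b → (∀ {i} → a ≤ i → i ≤ b → P (w i)) → Reach P E (w a) (w b)
  walk-reach w w-step {a} a≤b = go (≤⇒≤′ a≤b)
    where
    go : ∀ {b} → a ≤′ b → (∀ {i} → a ≤ i → i ≤ b → P (w i)) → Reach P E (w a) (w b)
    go (≤′-reflexive refl) P-w = here (P-w ≤-refl ≤-refl)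
    go (≤′-step a≤′b) P-w =
      step (go a≤′b (λ a≤i i≤b → P-w a≤i (m≤n⇒m≤1+n i≤b))) (w-step _) (P-w (≤′⇒≤ (≤′-step a≤′b)) ≤-refl)

[m+n%d]%d≡[m+n]%d : ∀ m n d .{{_ : NonZero d}} → (m + n % d) % d ≡ (m + n) % d
[m+n%d]%d≡[m+n]%d m n d = begin
  (m + n % d) % d         ≡⟨ %-distribˡ-+ m (n % d) d ⟩
  (m % d + n % d % d) % d ≡⟨ cong (λ t → (m % d + t) % d) (m%n%n≡m%n n d) ⟩
  (m % d + n % d) % d     ≡⟨ %-distribˡ-+ m n d ⟨
  (m + n) % d             ∎
  where open ≡-Reasoning

module _ {k : ℕ} .{{_ : NonZero k}} where

  CycNext⇒≡1+%k : ∀ {a b : Fin k} → CycNext k a b → toℕ b ≡ suc (toℕ a) % k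
  CycNext⇒≡1+%k {b = b} (inj₁ b≡1+a) =
    trans b≡1+a (sym (m<n⇒m%n≡m (subst (_< k) b≡1+a (toℕ<n b))))
  CycNext⇒≡1+%k (inj₂ (1+a≡k , b≡0)) = trans b≡0 (sym (trans (cong (_% k) 1+a≡k) (n%n≡0 k)))

  ≡1+%k⇒CycNext : ∀ {a b : Fin k} → toℕ b ≡ suc (toℕ a) % k → CycNext k a b
  ≡1+%k⇒CycNext {a} b≡ with m≤n⇒m<n∨m≡n (toℕ<n a)
  ... | inj₁ 1+a<k = inj₁ (trans b≡ (m<n⇒m%n≡m 1+a<k))
  ... | inj₂ 1+a≡k = inj₂ (1+a≡k , trans b≡ (trans (cong (_% k) 1+a≡k) (n%n≡0 k)))

  module Rotation (s : Fin k) where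

    rotate : ℕ → Fin k
    rotate i = (toℕ s + i) mod k

    unrotate : Fin k → ℕ
    unrotate j = (toℕ j + (k ∸ toℕ s)) % k

    toℕ-rotate : ∀ i → toℕ (rotate i) ≡ (toℕ s + i) % k
    toℕ-rotate i = toℕ-fromℕ< (m%n<n (toℕ s + i) k)

    private
      cancel : ∀ {a b} m → b + a ≡ k → (b + (a + m) % k) % k ≡ m % k
      cancel {a} {b} m b+a≡k = begin
        (b + (a + m) % k) % k ≡⟨ [m+n%d]%d≡[m+n]%d b (a + m) k ⟩
        (b + (a + m)) % k     ≡⟨ cong (_% k) (sym (+-assoc b a m)) ⟩
        (b + a + m) % k       ≡⟨ cong (λ t → (t + m) % k) b+a≡k ⟩
        (k + m) % k           ≡⟨ cong (_% k) (+-comm k m) ⟩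
        (m + k) % k           ≡⟨ [m+n]%n≡m%n m k ⟩
        m % k                 ∎
        where open ≡-Reasoning

      s+[k∸s]≡k : toℕ s + (k ∸ toℕ s) ≡ k
      s+[k∸s]≡k = m+[n∸m]≡n (<⇒≤ (toℕ<n s))

    rotate-unrotate : ∀ j → rotate (unrotate j) ≡ j
    rotate-unrotate j = toℕ-injective (begin
      toℕ (rotate (unrotate j))                  ≡⟨ toℕ-rotate (unrotate j) ⟩
      (toℕ s + (toℕ j + (k ∸ toℕ s)) % k) % k    ≡⟨ cong (λ t → (toℕ s + t % k) % k) (+-comm (toℕ j) _) ⟩
      (toℕ s + ((k ∸ toℕ s) + toℕ j) % k) % k    ≡⟨ cancel (toℕ j) s+[k∸s]≡k ⟩
      toℕ j % k                                  ≡⟨ m<n⇒m%n≡m (toℕ<n j) ⟩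
      toℕ j                                      ∎)
      where open ≡-Reasoning

    unrotate-rotate : ∀ {i} → i < k → unrotate (rotate i) ≡ i
    unrotate-rotate {i} i<k = begin
      (toℕ (rotate i) + (k ∸ toℕ s)) % k  ≡⟨ cong (λ t → (t + (k ∸ toℕ s)) % k) (toℕ-rotate i) ⟩
      ((toℕ s + i) % k + (k ∸ toℕ s)) % k ≡⟨ cong (_% k) (+-comm _ (k ∸ toℕ s)) ⟩
      ((k ∸ toℕ s) + (toℕ s + i) % k) % k ≡⟨ cancel i (m∸n+n≡m (<⇒≤ (toℕ<n s))) ⟩
      i % k                               ≡⟨ m<n⇒m%n≡m i<k ⟩
      i                                   ∎
      where open ≡-Reasoning

    rotate-injective : ∀ {i j} → i < k → j < k → rotate i ≡ rotate j → i ≡ j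
    rotate-injective {i} {j} i<k j<k eq =
      trans (sym (unrotate-rotate i<k)) (trans (cong unrotate eq) (unrotate-rotate j<k))

    rotate-onto : ∀ j → ∃ λ i → i < k × rotate i ≡ j
    rotate-onto j = unrotate j , m%n<n _ k , rotate-unrotate j

    rotate-0 : rotate 0 ≡ s
    rotate-0 = toℕ-injective (trans (toℕ-rotate 0)
      (trans (cong (_% k) (+-identityʳ (toℕ s))) (m<n⇒m%n≡m (toℕ<n s))))

    rotate-k : rotate k ≡ s
    rotate-k = toℕ-injective (trans (toℕ-rotate k)
      (trans ([m+n]%n≡m%n (toℕ s) k) (m<n⇒m%n≡m (toℕ<n s))))

    rotate-step : ∀ i → CycNext k (rotate i) (rotate (suc i))
    rotate-step i = ≡1+%k⇒CycNext (begin
      toℕ (rotate (suc i))       ≡⟨ toℕ-rotate (suc i) ⟩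
      (toℕ s + suc i) % k        ≡⟨ cong (_% k) (+-suc (toℕ s) i) ⟩
      (1 + (toℕ s + i)) % k      ≡⟨ [m+n%d]%d≡[m+n]%d 1 (toℕ s + i) k ⟨
      (1 + (toℕ s + i) % k) % k  ≡⟨ cong (λ t → suc t % k) (toℕ-rotate i) ⟨
      suc (toℕ (rotate i)) % k   ∎)
      where open ≡-Reasoning

    rotate-CycNext : ∀ {i j} → i < k → j < k → CycNext k (rotate i) (rotate j) →
                     j ≡ suc i ⊎ (suc i ≡ k × j ≡ 0)
    rotate-CycNext {i} {j} i<k j<k next with m≤n⇒m<n∨m≡n i<k
    ... | inj₁ 1+i<k = inj₁ (rotate-injective j<k 1+i<k j↦1+i)
      where
      j↦1+i : rotate j ≡ rotate (suc i)
      j↦1+i = toℕ-injective (trans (CycNext⇒≡1+%k next) (sym (CycNext⇒≡1+%k (rotate-step i))))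
    ... | inj₂ 1+i≡k = inj₂ (1+i≡k , rotate-injective j<k (>-nonZero⁻¹ k) j↦0)
      where
      j↦0 : rotate j ≡ rotate 0
      j↦0 = trans (toℕ-injective (trans (CycNext⇒≡1+%k next) (sym (CycNext⇒≡1+%k (rotate-step i)))))
                  (trans (cong rotate 1+i≡k) (trans rotate-k (sym rotate-0)))

module BurlingTreeProperties {n : ℕ} (B : BurlingTree n) where
  open BurlingTree B

  infix 4 _⊑_
  _⊑_ : Fin n → Fin n → Set
  u ⊑ v = Ancestor B u v

  ⊑-trans : ∀ {u v w} → u ⊑ v → v ⊑ w → u ⊑ w
  ⊑-trans u⊑v anc-refl = u⊑v
  ⊑-trans u⊑v (anc-step e u⊑w) = anc-step e (⊑-trans u⊑v u⊑w)

  parent-⊑ : ∀ {v w} → par v ≡ just w → w ⊑ v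
  parent-⊑ e = anc-step e anc-refl

  ancestors-comparable : ∀ {x y v} → x ⊑ v → y ⊑ v → x ⊑ y ⊎ y ⊑ x
  ancestors-comparable anc-refl y⊑v = inj₂ y⊑v
  ancestors-comparable (anc-step e x⊑w) anc-refl = inj₁ (anc-step e x⊑w)
  ancestors-comparable (anc-step e x⊑w) (anc-step e′ y⊑w′) with just-injective (trans (sym e) e′)
  ... | refl = ancestors-comparable x⊑w y⊑w′

  ⊑⇒≡⊎⊑parent : ∀ {x v w} → x ⊑ v → par v ≡ just w → x ≡ v ⊎ x ⊑ w
  ⊑⇒≡⊎⊑parent anc-refl _ = inj₁ refl
  ⊑⇒≡⊎⊑parent (anc-step e x⊑w) e′ with just-injective (trans (sym e) e′)
  ... | refl = inj₂ x⊑w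

  ancestors-split : ∀ {x y v w} → x ⊑ v → y ⊑ v → par y ≡ just w → y ⊑ x ⊎ x ⊑ w
  ancestors-split x⊑v y⊑v e with ancestors-comparable x⊑v y⊑v
  ... | inj₂ y⊑x = inj₁ y⊑x
  ... | inj₁ x⊑y with ⊑⇒≡⊎⊑parent x⊑y e
  ...   | inj₁ refl = inj₁ anc-refl
  ...   | inj₂ x⊑w = inj₂ x⊑w

  ¬⊑-parent : ∀ {v w} → par v ≡ just w → ¬ v ⊑ w
  ¬⊑-parent {v} = go (reach-root v)
    where
    go : ∀ {v w} → root ⊑ v → par v ≡ just w → ¬ v ⊑ w
    go anc-refl e _ with trans (sym e) par-root
    ... | ()
    go (anc-step e′ root⊑w) e v⊑w with just-injective (trans (sym e) e′)
    go (anc-step e′ root⊑w) e anc-refl             | refl = go root⊑w e anc-refl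
    go (anc-step e′ root⊑w) e (anc-step e₂ v⊑w₂) | refl = go root⊑w e₂ (⊑-trans (parent-⊑ e) v⊑w₂)

  ⊑-antisym : ∀ {x y} → x ⊑ y → y ⊑ x → x ≡ y
  ⊑-antisym anc-refl _ = refl
  ⊑-antisym (anc-step e x⊑w) y⊑x = ⊥-elim (¬⊑-parent e (⊑-trans y⊑x x⊑w))

  branch-interval : ∀ {s xs} → NonemptyBranch par s xs → ∃ λ b → ∀ {y} → y ∈ xs ⇔ (s ⊑ y × y ⊑ b)
  branch-interval {s} nb-one = s , mk⇔ to from
    where
    to : ∀ {y} → y ∈ s ∷ [] → s ⊑ y × y ⊑ s
    to (here refl) = anc-refl , anc-refl
    from : ∀ {y} → s ⊑ y × y ⊑ s → y ∈ s ∷ []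
    from (s⊑y , y⊑s) = here (⊑-antisym y⊑s s⊑y)
  branch-interval {s} (nb-more {y′} {ys} e nb) = b , mk⇔ to from
    where
    b = proj₁ (branch-interval nb)
    module IH {y} = Equivalence (proj₂ (branch-interval nb) {y})

    y′⊑b : y′ ⊑ b
    y′⊑b = proj₂ (IH.to (here refl))

    to : ∀ {y} → y ∈ s ∷ y′ ∷ ys → s ⊑ y × y ⊑ b
    to (here refl) = anc-refl , ⊑-trans (parent-⊑ e) y′⊑b
    to (there y∈) = ⊑-trans (parent-⊑ e) (proj₁ (IH.to y∈)) , proj₂ (IH.to y∈)

    from : ∀ {y} → s ⊑ y × y ⊑ b → y ∈ s ∷ y′ ∷ ys
    from (anc-refl , _) = here refl
    from {y} (anc-step e₁ s⊑z , y⊑b) = there (IH.from (y′⊑y , y⊑b))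
      where
      y′⊑y : y′ ⊑ y
      y′⊑y with ancestors-split y⊑b y′⊑b e
      ... | inj₁ y′⊑y = y′⊑y
      ... | inj₂ y⊑s = ⊥-elim (¬⊑-parent e₁ (⊑-trans y⊑s s⊑z))

  record OutInterval (u : Fin n) : Set where
    field
      parent      : Fin n
      par-u       : par u ≡ just parent
      ℓ-parent≢u  : ℓ parent ≢ u
      bottom      : Fin n
      out-nbrs    : ∀ {y} → Arc B u y ⇔ (ℓ parent ⊑ y × y ⊑ bottom)

    ℓ-parent-child : par (ℓ parent) ≡ just parent
    ℓ-parent-child = ℓ-child parent (u , par-u)

    ℓ-parent⊑ : ∀ {y} → Arc B u y → ℓ parent ⊑ y
    ℓ-parent⊑ = proj₁ ∘ Equivalence.to out-nbrs

    ⊑bottom : ∀ {y} → Arc B u y → y ⊑ bottom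
    ⊑bottom = proj₂ ∘ Equivalence.to out-nbrs

    interval⇒arc : ∀ {y} → ℓ parent ⊑ y → y ⊑ bottom → Arc B u y
    interval⇒arc ℓw⊑y y⊑b = Equivalence.from out-nbrs (ℓw⊑y , y⊑b)

  arc-source : ∀ {u v} → Arc B u v → OutInterval u
  arc-source {u} u→v with par u in par-u
  ... | nothing = ⊥-elim (∉[] (subst (_ ∈_) (trans (cong c (par-only-root u par-u)) c-root) u→v))
  ... | just w with ℓ w ≟ u
  ...   | yes ℓw≡u = ⊥-elim (∉[] (subst (_ ∈_) (c-last u w par-u ℓw≡u) u→v))
  ...   | no ℓw≢u with c-branch u w par-u ℓw≢u
  ...     | inj₁ cu≡[] = ⊥-elim (∉[] (subst (_ ∈_) cu≡[] u→v))
  ...     | inj₂ branch = record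
    { parent = w ; par-u = par-u ; ℓ-parent≢u = ℓw≢u
    ; bottom = proj₁ (branch-interval branch) ; out-nbrs = proj₂ (branch-interval branch) }

  arc-targets-comparable : ∀ {u x y} → Arc B u x → Arc B u y → x ⊑ y ⊎ y ⊑ x
  arc-targets-comparable u→x u→y = ancestors-comparable (⊑bottom u→x) (⊑bottom u→y)
    where open OutInterval (arc-source u→x)

  arc-asym : ∀ {a b} → Arc B a b → ¬ Arc B b a
  arc-asym {a} a→b b→a =
    [ ℓ-parent-b≢a , ℓ-parent-b⋢parent-a ]′ (⊑⇒≡⊎⊑parent (Ob.ℓ-parent⊑ b→a) Oa.par-u)
    where
    module Oa = OutInterval (arc-source a→b)
    module Ob = OutInterval (arc-source b→a)

    ℓ-parent-b≢a : ℓ Ob.parent ≢ a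
    ℓ-parent-b≢a ℓw₂≡a = Oa.ℓ-parent≢u (trans (cong ℓ w₁≡w₂) ℓw₂≡a)
      where
      w₁≡w₂ : Oa.parent ≡ Ob.parent
      w₁≡w₂ = just-injective (trans (sym Oa.par-u) (subst (λ v → par v ≡ just Ob.parent) ℓw₂≡a Ob.ℓ-parent-child))

    ℓ-parent-b⋢parent-a : ¬ ℓ Ob.parent ⊑ Oa.parent
    ℓ-parent-b⋢parent-a ℓw₂⊑w₁ =
      [ Ob.ℓ-parent≢u , ¬⊑-parent Ob.ℓ-parent-child ]′ (⊑⇒≡⊎⊑parent ℓw₂⊑b Ob.par-u)
      where
      ℓw₂⊑b : ℓ Ob.parent ⊑ _
      ℓw₂⊑b = ⊑-trans ℓw₂⊑w₁ (⊑-trans (parent-⊑ Oa.ℓ-parent-child) (Oa.ℓ-parent⊑ a→b))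

  arc-into-descendant : ∀ {t v u} → t ⊑ v → Arc B u v → Arc B u t ⊎ t ⊑ u
  arc-into-descendant t⊑v u→v =
    Sum.map (λ ℓw⊑t → interval⇒arc ℓw⊑t (⊑-trans t⊑v (⊑bottom u→v)))
            (λ t⊑w → ⊑-trans t⊑w (parent-⊑ par-u))
            (ancestors-split t⊑v (ℓ-parent⊑ u→v) ℓ-parent-child)
    where open OutInterval (arc-source u→v)

  arc-from-descendant : ∀ {t v u} → t ⊑ v → Arc B v u → v ≡ t ⊎ t ⊑ u
  arc-from-descendant t⊑v v→u =
    Sum.map sym (λ t⊑w → ⊑-trans t⊑w (⊑-trans (parent-⊑ ℓ-parent-child) (ℓ-parent⊑ v→u)))
            (⊑⇒≡⊎⊑parent t⊑v par-u)
    where open OutInterval (arc-source v→u)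

  neighbour-of-descendant : ∀ {t v u} → t ⊑ v → Adj B u v → Arc B u t ⊎ v ≡ t ⊎ t ⊑ u
  neighbour-of-descendant t⊑v (inj₁ u→v) = map₂ inj₂ (arc-into-descendant t⊑v u→v)
  neighbour-of-descendant t⊑v (inj₂ v→u) = inj₂ (arc-from-descendant t⊑v v→u)

  reach-descendant : ∀ {P : Fin n → Set} {t x y} → (∀ {v} → P v → v ≢ t × ¬ Arc B v t) →
                     t ⊑ x → Reach P (Adj B) x y → t ⊑ y
  reach-descendant P⇒ t⊑x (here _) = t⊑x
  reach-descendant P⇒ t⊑x (step x~y y~z Pz)
    with neighbour-of-descendant (reach-descendant P⇒ t⊑x x~y) (swap y~z)
  ... | inj₁ z→t = ⊥-elim (proj₂ (P⇒ Pz) z→t)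
  ... | inj₂ (inj₁ y≡t) = ⊥-elim (proj₁ (P⇒ (reach-end x~y)) y≡t)
  ... | inj₂ (inj₂ t⊑z) = t⊑z

Outside : ∀ {n} → BurlingTree n → (Fin n → Set) → Fin n → Fin n → Set
Outside B S p v = S v × ¬ InNminus B S p v

outside⇒≢×¬arc : ∀ {n} {B : BurlingTree n} {S p v} → Outside B S p v → v ≢ p × ¬ Arc B v p
outside⇒≢×¬arc (Sv , v∉N⁻) = (v∉N⁻ ∘ inj₁) , (λ v→p → v∉N⁻ (inj₂ (Sv , v→p)))

CyclicSucc : ℕ → ℕ → ℕ → Set
CyclicSucc m i j = j ≡ suc i ⊎ (i ≡ m × j ≡ 0)

record HoleWalk {n} (B : BurlingTree n) (S : Fin n → Set) (p : Fin n) : Set where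
  field
    m       : ℕ
    3≤m     : 3 ≤ m
    w       : ℕ → Fin n
    w-0     : w 0 ≡ p
    w-1+m   : w (suc m) ≡ p
    w-in-G  : ∀ i → S (w i)
    w-adj   : ∀ i → Adj B (w i) (w (suc i))
    w-inj   : ∀ {i j} → i ≤ m → j ≤ m → w i ≡ w j → i ≡ j
    w-chord : ∀ {i j} → i ≤ m → j ≤ m → Adj B (w i) (w j) → CyclicSucc m i j ⊎ CyclicSucc m j i

  OnWalk : Fin n → Set
  OnWalk x = ∃ λ i → i ≤ m × w i ≡ x

module HoleWalkFrom {n} {B : BurlingTree n} {S} (H : Hole B S) {p} (p∈H : InH H p) where
  open Hole H

  instance
    k-nonZero : NonZero k
    k-nonZero = >-nonZero (≤-trans (s≤s z≤n) k≥4)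

  open Rotation (proj₁ p∈H)

  private
    ≤pred⇒< : ∀ {i} → i ≤ pred k → i < k
    ≤pred⇒< i≤m = subst (_ <_) (suc-pred k) (s≤s i≤m)

  walk : HoleWalk B S p
  walk = record
    { m       = pred k
    ; 3≤m     = ≤-pred (subst (4 ≤_) (sym (suc-pred k)) k≥4)
    ; w       = h ∘ rotate
    ; w-0     = trans (cong h rotate-0) (proj₂ p∈H)
    ; w-1+m   = trans (cong (h ∘ rotate) (suc-pred k)) (trans (cong h rotate-k) (proj₂ p∈H))
    ; w-in-G  = h-in-G ∘ rotate
    ; w-adj   = λ i → cyc→adj _ _ (rotate-step i)
    ; w-inj   = λ i≤m j≤m wi≡wj → rotate-injective (≤pred⇒< i≤m) (≤pred⇒< j≤m) (h-inj _ _ wi≡wj)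
    ; w-chord = λ i≤m j≤m adj → Sum.map (cyclic-succ i≤m j≤m) (cyclic-succ j≤m i≤m) (adj→cyc _ _ adj)
    }
    where
    cyclic-succ : ∀ {i j} → i ≤ pred k → j ≤ pred k → CycNext k (rotate i) (rotate j) → CyclicSucc (pred k) i j
    cyclic-succ i≤m j≤m next =
      map₂ (Product.map₁ (cong pred)) (rotate-CycNext (≤pred⇒< i≤m) (≤pred⇒< j≤m) next)

  walk-in-hole : ∀ i → InH H (HoleWalk.w walk i)
  walk-in-hole i = rotate i , refl

  walk-onto : ∀ {x} → InH H x → HoleWalk.OnWalk walk x
  walk-onto (j , refl) with rotate-onto j
  ... | i , i<k , refl = i , <⇒≤pred i<k , refl

far-apart : ∀ {i j} → suc j < i ⊎ suc i < j → i ≢ j × j ≢ suc i × i ≢ suc j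
far-apart {i} {j} (inj₁ 1+j<i) =
  >⇒≢ j<i , <⇒≢ (<-trans j<i (n<1+n i)) , >⇒≢ 1+j<i
  where j<i = <-trans (n<1+n j) 1+j<i
far-apart {i} {j} (inj₂ 1+i<j) =
  <⇒≢ i<j , >⇒≢ 1+i<j , <⇒≢ (<-trans i<j (n<1+n j))
  where i<j = <-trans (n<1+n i) 1+i<j

module HoleWalkProperties {n} {B : BurlingTree n} {S} {p} (W : HoleWalk B S p) where
  open HoleWalk W
  open BurlingTreeProperties B

  w≢p : ∀ {i} → 1 ≤ i → i ≤ m → w i ≢ p
  w≢p (s≤s _) i≤m wi≡p with w-inj i≤m z≤n (trans wi≡p (sym w-0))
  ... | ()

  inner-chord : ∀ {i j} → 1 ≤ i → i ≤ m → 1 ≤ j → j ≤ m → Adj B (w i) (w j) → j ≡ suc i ⊎ i ≡ suc j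
  inner-chord 1≤i i≤m 1≤j j≤m adj with w-chord i≤m j≤m adj
  ... | inj₁ (inj₁ j≡1+i) = inj₁ j≡1+i
  ... | inj₁ (inj₂ (_ , j≡0)) = ⊥-elim (<⇒≢ 1≤j (sym j≡0))
  ... | inj₂ (inj₁ i≡1+j) = inj₂ i≡1+j
  ... | inj₂ (inj₂ (_ , i≡0)) = ⊥-elim (<⇒≢ 1≤i (sym i≡0))

  pivot-neighbour : ∀ {i} → i ≤ m → Adj B (w i) p → i ≡ 1 ⊎ i ≡ m
  pivot-neighbour i≤m adj with w-chord i≤m z≤n (subst (Adj B (w _)) (sym w-0) adj)
  ... | inj₁ (inj₁ ())
  ... | inj₁ (inj₂ (i≡m , _)) = inj₂ i≡m
  ... | inj₂ (inj₁ i≡1) = inj₁ i≡1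
  ... | inj₂ (inj₂ (0≡m , _)) = ⊥-elim (<⇒≢ (≤-trans (s≤s z≤n) 3≤m) 0≡m)

  antennas-at-ends : ∀ {a a′} → OnWalk a → OnWalk a′ → a ≢ a′ → Arc B a p → Arc B a′ p →
                     Arc B (w 1) p × Arc B (w m) p
  antennas-at-ends (i , i≤m , refl) (i′ , i′≤m , refl) a≢a′ a→p a′→p
    with pivot-neighbour i≤m (inj₁ a→p) | pivot-neighbour i′≤m (inj₁ a′→p)
  ... | inj₁ i≡1 | inj₁ i′≡1 = ⊥-elim (a≢a′ (cong w (trans i≡1 (sym i′≡1))))
  ... | inj₂ i≡m | inj₂ i′≡m = ⊥-elim (a≢a′ (cong w (trans i≡m (sym i′≡m))))
  ... | inj₁ i≡1 | inj₂ i′≡m = subst (λ t → Arc B (w t) p) i≡1 a→p , subst (λ t → Arc B (w t) p) i′≡m a′→p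
  ... | inj₂ i≡m | inj₁ i′≡1 = subst (λ t → Arc B (w t) p) i′≡1 a′→p , subst (λ t → Arc B (w t) p) i≡m a→p

  module Pivoted (p-top : ∀ i → w i ⊑ p → w i ≡ p) (a₁ : Arc B (w 1) p) (a₂ : Arc B (w m) p) where

    inner-⋢p : ∀ {i} → 1 ≤ i → i ≤ m → ¬ w i ⊑ p
    inner-⋢p 1≤i i≤m wi⊑p = w≢p 1≤i i≤m (p-top _ wi⊑p)

    ¬pivot→inner : ∀ {i} → i ≤ m → ¬ Arc B p (w i)
    ¬pivot→inner i≤m p→wi with pivot-neighbour i≤m (inj₂ p→wi)
    ... | inj₁ refl = arc-asym a₁ p→wi
    ... | inj₂ i≡m = arc-asym a₂ (subst (λ t → Arc B p (w t)) i≡m p→wi)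

    ¬⊑-across : ∀ {j l} → 1 ≤ j → j ≤ m → 1 ≤ l → l ≤ m → suc j < l ⊎ suc l < j → ¬ w j ⊑ w l
    ¬⊑-across {j} {l} 1≤j j≤m 1≤l l≤m far wj⊑wl =
      inner-⋢p 1≤j j≤m (reach-descendant id wj⊑wl (l-to-p far))
      where
      Away : Fin n → Set
      Away v = v ≢ w j × ¬ Arc B v (w j)

      away-pivot : Away p
      away-pivot = (λ p≡wj → w≢p 1≤j j≤m (sym p≡wj)) , ¬pivot→inner j≤m

      away-inner : ∀ {i} → 1 ≤ i → i ≤ m → suc j < i ⊎ suc i < j → Away (w i)
      away-inner 1≤i i≤m i-far with far-apart i-far
      ... | i≢j , j≢1+i , i≢1+j =
        (i≢j ∘ w-inj i≤m j≤m) , (λ wi→wj → [ j≢1+i , i≢1+j ]′ (inner-chord 1≤i i≤m 1≤j j≤m (inj₁ wi→wj)))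

      l-to-p : suc j < l ⊎ suc l < j → Reach Away (Adj B) (w l) p
      l-to-p (inj₁ 1+j<l) =
        subst (Reach Away (Adj B) (w l)) w-1+m (walk-reach w w-adj (m≤n⇒m≤1+n l≤m) away-after)
        where
        away-after : ∀ {i} → l ≤ i → i ≤ suc m → Away (w i)
        away-after l≤i i≤1+m with m≤n⇒m<n∨m≡n i≤1+m
        ... | inj₁ i<1+m = away-inner (≤-trans 1≤l l≤i) (≤-pred i<1+m) (inj₁ (<-≤-trans 1+j<l l≤i))
        ... | inj₂ i≡1+m = subst Away (sym (trans (cong w i≡1+m) w-1+m)) away-pivot
      l-to-p (inj₂ 1+l<j) =
        reach-sym swap (subst (λ v → Reach Away (Adj B) v (w l)) w-0 (walk-reach w w-adj z≤n away-before))
        where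
        away-before : ∀ {i} → 0 ≤ i → i ≤ l → Away (w i)
        away-before {zero} _ _ = subst Away (sym w-0) away-pivot
        away-before {suc i} _ i<l = away-inner (s≤s z≤n) (≤-trans i<l l≤m) (inj₂ (≤-<-trans (s≤s i<l) 1+l<j))

    ¬inner-source : ∀ {j} → 1 ≤ j → 2 + j ≤ m →
                    Arc B (w (suc j)) (w j) → ¬ Arc B (w (suc j)) (w (2 + j))
    ¬inner-source {j} 1≤j 2+j≤m back fwd =
      [ ¬⊑-across 1≤j j≤m (s≤s z≤n) 2+j≤m (inj₁ ≤-refl)
      , ¬⊑-across (s≤s z≤n) 2+j≤m 1≤j j≤m (inj₂ ≤-refl) ]′ (arc-targets-comparable back fwd)
      where j≤m = ≤-trans (m≤n+m j 2) 2+j≤m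

    arcs-point-back : Arc B (w 2) (w 1) → ∀ i → 2 + i ≤ m → Arc B (w (2 + i)) (w (1 + i))
    arcs-point-back w2→w1 zero _ = w2→w1
    arcs-point-back w2→w1 (suc i) 3+i≤m =
      [ ⊥-elim ∘ ¬inner-source (s≤s z≤n) 3+i≤m previous , id ]′ (w-adj (2 + i))
      where
      previous : Arc B (w (2 + i)) (w (1 + i))
      previous = arcs-point-back w2→w1 i (≤-trans (n≤1+n _) 3+i≤m)

    pivot-above-interior-vertex : ∃ λ g → 2 ≤ g × suc g ≤ m × p ⊑ w g
    pivot-above-interior-vertex = [ via-w₂ , via-wₘ₋₁ ]′ (w-adj 1)
      where
      Goal = ∃ λ g → 2 ≤ g × suc g ≤ m × p ⊑ w g

      comparable-interior : ∀ {g} → 2 ≤ g → suc g ≤ m → p ⊑ w g ⊎ w g ⊑ p → Goal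
      comparable-interior 2≤g 1+g≤m =
        [ (λ p⊑wg → _ , 2≤g , 1+g≤m , p⊑wg) , ⊥-elim ∘ inner-⋢p (≤-trans (n≤1+n 1) 2≤g) (<⇒≤ 1+g≤m) ]′

      via-w₂ : Arc B (w 1) (w 2) → Goal
      via-w₂ w1→w2 = comparable-interior ≤-refl 3≤m (arc-targets-comparable a₁ w1→w2)

      via-wₘ₋₁ : Arc B (w 2) (w 1) → Goal
      via-wₘ₋₁ w2→w1 = comparable-interior (s≤s (∸-monoˡ-≤ 2 3≤m)) (≤-reflexive 2+i≡m)
                                           (arc-targets-comparable a₂ wm→w1+i)
        where
        i = m ∸ 2
        2+i≡m : 2 + i ≡ m
        2+i≡m = m+[n∸m]≡n (≤-trans (n≤1+n 2) 3≤m)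
        wm→w1+i : Arc B (w m) (w (1 + i))
        wm→w1+i = subst (λ t → Arc B (w t) (w (1 + i))) 2+i≡m (arcs-point-back w2→w1 i (≤-reflexive 2+i≡m))

    interior-outside : ∀ {i} → 2 ≤ i → suc i ≤ m → Outside B S p (w i)
    interior-outside {i} 2≤i 1+i≤m = w-in-G i , λ where
      (inj₁ wi≡p) → w≢p (≤-trans (n≤1+n 1) 2≤i) (<⇒≤ 1+i≤m) wi≡p
      (inj₂ (_ , wi→p)) → [ <⇒≢ 2≤i ∘ sym , <⇒≢ 1+i≤m ]′ (pivot-neighbour (<⇒≤ 1+i≤m) (inj₁ wi→p))

    interior-connected : ∀ {g i} → 2 ≤ g → suc g ≤ m → 2 ≤ i → suc i ≤ m →
                         Reach (Outside B S p) (Adj B) (w g) (w i)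
    interior-connected {g} {i} 2≤g 1+g≤m 2≤i 1+i≤m with ≤-total g i
    ... | inj₁ g≤i = walk-reach w w-adj g≤i
          (λ g≤j j≤i → interior-outside (≤-trans 2≤g g≤j) (≤-<-trans j≤i 1+i≤m))
    ... | inj₂ i≤g = reach-sym swap (walk-reach w w-adj i≤g
          (λ i≤j j≤g → interior-outside (≤-trans 2≤i i≤j) (≤-<-trans j≤g 1+g≤m)))

    interior-descends : ∀ {i} → 2 ≤ i → suc i ≤ m → p ⊑ w i
    interior-descends 2≤i 1+i≤m with pivot-above-interior-vertex
    ... | g , 2≤g , 1+g≤m , p⊑wg =
      reach-descendant (outside⇒≢×¬arc {B = B} {S}) p⊑wg (interior-connected 2≤g 1+g≤m 2≤i 1+i≤m)

    outside-is-interior : ∀ {i} → i ≤ m → ¬ InNminus B S p (w i) → 2 ≤ i × suc i ≤ m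
    outside-is-interior {zero} _ wi∉N⁻ = ⊥-elim (wi∉N⁻ (inj₁ w-0))
    outside-is-interior {suc zero} _ wi∉N⁻ = ⊥-elim (wi∉N⁻ (inj₂ (w-in-G 1 , a₁)))
    outside-is-interior {suc (suc i)} i≤m wi∉N⁻ with m≤n⇒m<n∨m≡n i≤m
    ... | inj₁ i<m = s≤s (s≤s z≤n) , i<m
    ... | inj₂ i≡m = ⊥-elim (wi∉N⁻ (inj₂ (w-in-G _ , subst (λ t → Arc B (w t) p) (sym i≡m) a₂)))

    component-descends : ∀ {x y} → OnWalk x → ¬ InNminus B S p x →
                         Reach (Outside B S p) (Adj B) x y → p ⊑ y
    component-descends (i , i≤m , refl) x∉N⁻ =
      reach-descendant (outside⇒≢×¬arc {B = B} {S}) (Product.uncurry interior-descends (outside-is-interior i≤m x∉N⁻))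


lemma6p1 : ∀ {n : ℕ} (B : BurlingTree n) (S : Fin n → Set) (H : Hole B S)
           (p : Fin n) → IsPivot H p →
           ∀ x → InH H x → ¬ InNminus B S p x →
           ∀ y → Reach (λ v → S v × ¬ InNminus B S p v) (Adj B) x y →
           Ancestor B p y
lemma6p1 B S H p ((p∈H , p-top) , a , a′ , (a∈H , _) , (a′∈H , _) , a≢a′ , _ , _ , a→p , a′→p)
         x x∈H x∉N⁻ y x~y =
  Pivoted.component-descends (λ i → p-top _ (walk-in-hole i)) a₁ a₂ (walk-onto x∈H) x∉N⁻ x~y
  where
  open HoleWalkFrom H p∈H
  open HoleWalkProperties walk
  antennas = antennas-at-ends (walk-onto a∈H) (walk-onto a′∈H) a≢a′ a→p a′→p
  a₁ = proj₁ antennas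
  a₂ = proj₂ antennas
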